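{- Let $X\in\mathbf{Set}^{\mathbb{F}}$ and let $\langle c_1,c_2\rangle\colon W\to\langle\!\langle X,W\rangle\!\rangle\times(W+W^X+1)$ and $\langle d_1,d_2\rangle\colon Z\to\langle\!\langle X,Z\rangle\!\rangle\times(Z+Z^X+1)$ be $B(X,-)$-coalgebras. A family of relations $R(n)\subseteq W(n)\times Z(n)$, $n\in\mathbb{F}$, is a bisimulation if and only if for all $n\in\mathbb{F}$ and all $w\,R(n)\,z$ the following hold: (1) $W(r)(w)\,R(m)\,Z(r)(z)$ for all $r\colon n\to m$; (2) $c_1(w)(\vec u)\,R(m)\,d_1(z)(\vec u)$ for all $m\in\mathbb{F}$ and $\vec u\in X(m)^n$; (3) if $c_2(w)=w'\in W(n)$ then $d_2(z)=z'\in Z(n)$ for some $z'$ with $w'\,R(n)\,z'$; (4) if $c_2(w)=f\in W^X(n)$ then $d_2(z)=g\in Z^X(n)$ for some $g$ with $f(e)\,R(n)\,g(e)$ for all $e\in X(n)$; (5) if $c_2(w)=*$ then $d_2(z)=*$; (6) if $d_2(z)=z'\in Z(n)$ then $c_2(w)=w'\in W(n)$ for some $w'$ with $w'\,R(n)\,z'$; (7) if $d_2(z)=g\in Z^X(n)$ then $c_2(w)=f\in W^X(n)$ for some $f$ with $f(e)\,R(n)\,g(e)$ for all $e\in X(n)$; (8) if $d_2(z)=*$ then $c_2(w)=*$.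
   Context: $\mathbb{F}$ is the category of finite cardinals $n=\{0,\dots,n-1\}$ and all functions; $\mathbf{Set}^{\mathbb{F}}$ is the category of functors $\mathbb{F}\to\mathbf{Set}$. $\langle\!\langle X,Y\rangle\!\rangle(n)=\mathrm{Nat}(X^n,Y)$, with $\langle\!\langle X,Y\rangle\!\rangle(r)(f)=f\circ X^r$ for $r\colon n\to m$, where $X^r\colon X^m\to X^n$ reindexes tuples by $r$; for $f\in\langle\!\langle X,Y\rangle\!\rangle(n)$ and $\vec u\in X(m)^n$, $f(\vec u)$ means $f_m(\vec u)\in Y(m)$. $Y^X$ is the exponential presheaf, $Y^X(n)=\mathrm{Nat}(\mathbb{F}(n,-)\times X,Y)$, and for $f\in Y^X(n)$, $e\in X(n)$ we write $f(e)=f_n(\mathrm{id}_n,e)\in Y(n)$. $B(X,Y)=\langle\!\langle X,Y\rangle\!\rangle\times(Y+Y^X+1)$; a $B(X,-)$-coalgebra is a presheaf $W$ with a natural transformation $W\to B(X,W)$; components of natural transformations are written without subscripts, and $*$ denotes the element of $1$. A bisimulation between two $B(X,-)$-coalgebras on $W$ and $Z$ is a sub-presheaf $R\subseteq W\times Z$ that admits a $B(X,-)$-coalgebra structure $R\to B(X,R)$ making both projections $R\to W$ and $R\to Z$ coalgebra morphisms. -}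

module Defs where

open import Level using (0ℓ)
open import Data.Nat using (ℕ)
open import Data.Fin using (Fin)
open import Data.Unit using (⊤; tt)
open import Data.Product using (Σ; Σ-syntax; ∃; ∃-syntax; _×_; _,_; proj₁; proj₂)
open import Data.Sum using (_⊎_; inj₁; inj₂)
import Data.Sum as Sum
open import Data.Sum.Relation.Binary.Pointwise using (Pointwise; ⊎-isEquivalence)
open import Data.Product.Relation.Binary.Pointwise.NonDependent using (×-isEquivalence)
open import Function using (_∘_; id)
open import Relation.Binary using (Rel; IsEquivalence)
open import Relation.Binary.PropositionalEquality
  using (_≡_; refl; sym; trans; cong; isEquivalence)

-- Presheaves 𝔽 → Set (genuine functors, laws up to ≡).
-- A morphism r : n → m of 𝔽 is a function Fin n → Fin m; extensionally
-- equal functions are the same morphism, hence act-cong.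

record Presheaf : Set₁ where
  field
    Ob     : ℕ → Set
    act    : ∀ {n m} → (Fin n → Fin m) → Ob n → Ob m
    act-cong : ∀ {n m} {r s : Fin n → Fin m} →
               (∀ i → r i ≡ s i) → ∀ x → act r x ≡ act s x
    act-id : ∀ {n} (x : Ob n) → act id x ≡ x
    act-∘  : ∀ {n m k} (r : Fin n → Fin m) (s : Fin m → Fin k) (x : Ob n) →
             act (s ∘ r) x ≡ act s (act r x)

-- Used for the derived presheaves
-- (X^n, 𝔽(n,-)×X, ⟨⟨X,Y⟩⟩, Y^X, B(X,Y), and the relation R viewed as a
-- sub-presheaf of W×Z), whose elements are functions / tuples / subset
-- elements, and whose true equality is therefore extensional.

record PSh : Set₁ where
  field
    Ob    : ℕ → Set
    _≈_   : ∀ {n} → Rel (Ob n) 0ℓ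
    ≈-eq  : ∀ {n} → IsEquivalence (_≈_ {n})
    act   : ∀ {n m} → (Fin n → Fin m) → Ob n → Ob m

U : Presheaf → PSh
U P = record { Ob = Ob ; _≈_ = _≡_ ; ≈-eq = isEquivalence ; act = act }
  where open Presheaf P

record Nat (D C : PSh) : Set where
  private
    module D = PSh D
    module C = PSh C
  field
    η       : ∀ k → D.Ob k → C.Ob k
    η-cong  : ∀ {k} {a b : D.Ob k} → a D.≈ b → η k a C.≈ η k b
    natural : ∀ {k l} (s : Fin k → Fin l) (a : D.Ob k) →
              η l (D.act s a) C.≈ C.act s (η k a)
open Nat public

_≈Nat_ : ∀ {D C : PSh} → Rel (Nat D C) 0ℓ
_≈Nat_ {D} {C} f g = ∀ k (a : PSh.Ob D k) → PSh._≈_ C (η f k a) (η g k a)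

≈Nat-eq : ∀ {D C : PSh} → IsEquivalence (_≈Nat_ {D} {C})
≈Nat-eq {D} {C} = record
  { refl  = λ k a → IsEquivalence.refl (PSh.≈-eq C)
  ; sym   = λ p k a → IsEquivalence.sym (PSh.≈-eq C) (p k a)
  ; trans = λ p q k a → IsEquivalence.trans (PSh.≈-eq C) (p k a) (q k a) }

module _ (X : Presheaf) where
  private module X = Presheaf X

  Pow : ℕ → PSh
  Pow n = record
    { Ob   = λ k → Fin n → X.Ob k
    ; _≈_  = λ u v → ∀ i → u i ≡ v i
    ; ≈-eq = record { refl = λ i → refl ; sym = λ p i → sym (p i)
                    ; trans = λ p q i → trans (p i) (q i) }
    ; act  = λ s u i → X.act s (u i) }

  RepX : ℕ → PSh
  RepX n = record
    { Ob   = λ k → (Fin n → Fin k) × X.Ob k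
    ; _≈_  = λ { (r , x) (r' , x') → (∀ i → r i ≡ r' i) × x ≡ x' }
    ; ≈-eq = record
        { refl  = (λ i → refl) , refl
        ; sym   = λ { (p , q) → (λ i → sym (p i)) , sym q }
        ; trans = λ { (p , q) (p' , q') → (λ i → trans (p i) (p' i)) , trans q q' } }
    ; act  = λ { s (r , x) → (s ∘ r , X.act s x) } }

  module _ (Y : PSh) where
    -- ⟨⟨X,Y⟩⟩(n) = Nat(X^n, Y),  ⟨⟨X,Y⟩⟩(r)(f) = f ∘ X^r
    Hom : PSh
    Hom = record
      { Ob   = λ n → Nat (Pow n) Y
      ; _≈_  = _≈Nat_
      ; ≈-eq = ≈Nat-eq
      ; act  = λ r f → record
          { η       = λ k u → η f k (u ∘ r)
          ; η-cong  = λ p → η-cong f (p ∘ r)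
          ; natural = λ s u → natural f s (u ∘ r) } }

    -- Y^X(n) = Nat(𝔽(n,-) × X, Y)
    Exp : PSh
    Exp = record
      { Ob   = λ n → Nat (RepX n) Y
      ; _≈_  = _≈Nat_
      ; ≈-eq = ≈Nat-eq
      ; act  = λ r f → record
          { η       = λ { k (s , x) → η f k (s ∘ r , x) }
          ; η-cong  = λ { (p , q) → η-cong f ((λ i → p (r i)) , q) }
          ; natural = λ { t (s , x) → natural f t (s ∘ r , x) } } }

    BX : PSh
    BX = record
      { Ob   = λ n → PSh.Ob Hom n × (PSh.Ob Y n ⊎ (PSh.Ob Exp n ⊎ ⊤))
      ; _≈_  = λ { (h , t) (h' , t') →
                 (h ≈Nat h') × Pointwise (PSh._≈_ Y) (Pointwise _≈Nat_ _≡_) t t' }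
      ; ≈-eq = ×-isEquivalence ≈Nat-eq
                 (⊎-isEquivalence (PSh.≈-eq Y) (⊎-isEquivalence ≈Nat-eq isEquivalence))
      ; act  = λ { r (h , t) →
                 PSh.act Hom r h , Sum.map (PSh.act Y r) (Sum.map (PSh.act Exp r) id) t } }

  app : ∀ {Y : PSh} {n} → PSh.Ob (Exp Y) n → X.Ob n → PSh.Ob Y n
  app {n = n} f e = η f n (id , e)

  postcomp : ∀ {D Y Y' : PSh} → Nat Y Y' → Nat D Y → Nat D Y'
  postcomp {D} {Y} {Y'} h f = record
    { η       = λ k a → η h k (η f k a)
    ; η-cong  = λ p → η-cong h (η-cong f p)
    ; natural = λ s a → IsEquivalence.trans (PSh.≈-eq Y')
                          (η-cong h (natural f s a)) (natural h s (η f _ a)) }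

  Bmap : ∀ {Y Y' : PSh} → Nat Y Y' → ∀ {n} → PSh.Ob (BX Y) n → PSh.Ob (BX Y') n
  Bmap {Y} {Y'} h {n} (f , t) =
    postcomp h f , Sum.map (η h n) (Sum.map (postcomp h) id) t

  Coalg : PSh → Set
  Coalg Y = Nat Y (BX Y)

  IsCoalgMorphism : ∀ {Y Y' : PSh} → Coalg Y → Coalg Y' → Nat Y Y' → Set
  IsCoalgMorphism {Y} {Y'} γ γ' h =
    ∀ n (y : PSh.Ob Y n) → PSh._≈_ (BX Y') (Bmap h (η γ n y)) (η γ' n (η h n y))

FamRel : Presheaf → Presheaf → Set₁
FamRel W Z = ∀ n → Presheaf.Ob W n → Presheaf.Ob Z n → Set

IsSubPresheaf : ∀ (W Z : Presheaf) → FamRel W Z → Set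
IsSubPresheaf W Z R = ∀ {n m} (r : Fin n → Fin m) w z → R n w z →
  R m (Presheaf.act W r w) (Presheaf.act Z r z)

SubPSh : ∀ (W Z : Presheaf) (R : FamRel W Z) → IsSubPresheaf W Z R → PSh
SubPSh W Z R cl = record
  { Ob   = λ n → Σ[ w ∈ Presheaf.Ob W n ] Σ[ z ∈ Presheaf.Ob Z n ] R n w z
  ; _≈_  = λ { (w , z , _) (w' , z' , _) → w ≡ w' × z ≡ z' }
  ; ≈-eq = record
      { refl  = refl , refl
      ; sym   = λ { (p , q) → sym p , sym q }
      ; trans = λ { (p , q) (p' , q') → trans p p' , trans q q' } }
  ; act  = λ { r (w , z , p) → Presheaf.act W r w , Presheaf.act Z r z , cl r w z p } }

π₁ : ∀ {W Z : Presheaf} {R : FamRel W Z} (cl : IsSubPresheaf W Z R) → Nat (SubPSh W Z R cl) (U W)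
π₁ cl = record
  { η = λ { k (w , _ , _) → w } ; η-cong = proj₁ ; natural = λ s a → refl }

π₂ : ∀ {W Z : Presheaf} {R : FamRel W Z} (cl : IsSubPresheaf W Z R) → Nat (SubPSh W Z R cl) (U Z)
π₂ cl = record
  { η = λ { k (_ , z , _) → z } ; η-cong = proj₂ ; natural = λ s a → refl }

IsBisimulation : ∀ (X W Z : Presheaf) → Coalg X (U W) → Coalg X (U Z) →
                 FamRel W Z → Set
IsBisimulation X W Z c d R =
  Σ[ cl ∈ IsSubPresheaf W Z R ]
  Σ[ ρ ∈ Coalg X (SubPSh W Z R cl) ]
    IsCoalgMorphism X ρ c (π₁ {W} {Z} {R} cl) × IsCoalgMorphism X ρ d (π₂ {W} {Z} {R} cl)

module _ {X : Presheaf} {Y : PSh} (c : Coalg X Y) {n : ℕ} (y : PSh.Ob Y n) where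
  comp₁ : PSh.Ob (Hom X Y) n
  comp₁ = proj₁ (η c n y)

  comp₂ : PSh.Ob Y n ⊎ (PSh.Ob (Exp X Y) n ⊎ ⊤)
  comp₂ = proj₂ (η c n y)

module _ (X W Z : Presheaf) (c : Coalg X (U W)) (d : Coalg X (U Z))
         (R : FamRel W Z) {n : ℕ}
         (w : Presheaf.Ob W n) (z : Presheaf.Ob Z n) where
  private
    module X = Presheaf X
    module W = Presheaf W
    module Z = Presheaf Z
    c₁ = comp₁ {X} {U W} c w
    c₂ = comp₂ {X} {U W} c w
    d₁ = comp₁ {X} {U Z} d z
    d₂ = comp₂ {X} {U Z} d z

  Cond1 Cond2 Cond3 Cond4 Cond5 Cond6 Cond7 Cond8 : Set
  Cond1 = ∀ {m} (r : Fin n → Fin m) → R m (W.act r w) (Z.act r z)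
  Cond2 = ∀ m (u : Fin n → X.Ob m) →
          R m (η (c₁) m u) (η (d₁) m u)
  Cond3 = ∀ w' → c₂ ≡ inj₁ w' →
          ∃[ z' ] (d₂ ≡ inj₁ z' × R n w' z')
  Cond4 = ∀ f → c₂ ≡ inj₂ (inj₁ f) →
          ∃[ g ] (d₂ ≡ inj₂ (inj₁ g) ×
                  (∀ e → R n (app X {U W} f e) (app X {U Z} g e)))
  Cond5 = c₂ ≡ inj₂ (inj₂ tt) → d₂ ≡ inj₂ (inj₂ tt)
  Cond6 = ∀ z' → d₂ ≡ inj₁ z' →
          ∃[ w' ] (c₂ ≡ inj₁ w' × R n w' z')
  Cond7 = ∀ g → d₂ ≡ inj₂ (inj₁ g) →
          ∃[ f ] (c₂ ≡ inj₂ (inj₁ f) ×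
                  (∀ e → R n (app X {U W} f e) (app X {U Z} g e)))
  Cond8 = d₂ ≡ inj₂ (inj₂ tt) → c₂ ≡ inj₂ (inj₂ tt)

  Conditions : Set
  Conditions = Cond1 × Cond2 × Cond3 × Cond4 × Cond5 × Cond6 × Cond7 × Cond8

module Submission where

-- Conditions (3)–(8) say exactly that c₂(w) and d₂(z) are related by the
-- lifting of R to Y + Y^X + 1, and (1), (2) that R is a sub-presheaf on which
-- c₁ and d₁ can be paired.  So a bisimulation structure on R is obtained by
-- pairing c and d componentwise, and conversely the projections of such a
-- structure yield the conditions.  The one subtle point is that an element of
-- R^X(n) must relate f and g at every stage r : n → m, not only at id; this
-- comes from (4) at W(r)(w) R Z(r)(z), transported along the naturality of
-- c and d.

open import Level using (0ℓ)
open import Data.Nat using (ℕ)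
open import Data.Fin using (Fin)
open import Data.Unit using (⊤; tt)
open import Data.Product using (Σ-syntax; ∃-syntax; _×_; _,_; proj₁; proj₂)
open import Data.Sum using (_⊎_; inj₁; inj₂)
import Data.Sum as Sum
open import Data.Sum.Relation.Binary.Pointwise
  using (Pointwise; inj₁; inj₂; ⊎-isEquivalence)
open import Function using (id; _∘_)
open import Function.Bundles using (_⇔_; mk⇔)
open import Relation.Binary using (Rel; IsEquivalence)
open import Relation.Binary.PropositionalEquality
  using (_≡_; refl; cong; subst₂; isEquivalence)

open import Defs

module Step (X : Presheaf) (Y : PSh) where

  Ob : ℕ → Set
  Ob n = PSh.Ob Y n ⊎ (PSh.Ob (Exp X Y) n ⊎ ⊤)

  _≈_ : ∀ {n} → Rel (Ob n) 0ℓ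
  _≈_ = Pointwise (PSh._≈_ Y) (Pointwise _≈Nat_ _≡_)

  ≈-isEquivalence : ∀ {n} → IsEquivalence (_≈_ {n})
  ≈-isEquivalence = ⊎-isEquivalence (PSh.≈-eq Y) (⊎-isEquivalence ≈Nat-eq isEquivalence)

  ≈-sym : ∀ {n} {s t : Ob n} → s ≈ t → t ≈ s
  ≈-sym = IsEquivalence.sym ≈-isEquivalence

  ≈-trans : ∀ {n} {s t u : Ob n} → s ≈ t → t ≈ u → s ≈ u
  ≈-trans = IsEquivalence.trans ≈-isEquivalence

  act : ∀ {n m} → (Fin n → Fin m) → Ob n → Ob m
  act r = Sum.map (PSh.act Y r) (Sum.map (PSh.act (Exp X Y) r) id)

module StepMap (X : Presheaf) where
  open Step X using (Ob; _≈_; act; ≈-trans; ≈-sym)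

  Step-map : ∀ {Y Y'} → Nat Y Y' → ∀ {n} → Ob Y n → Ob Y' n
  Step-map h {n} = Sum.map (η h n) (Sum.map (postcomp X h) id)

  Step-map-act : ∀ {Y Y'} (h : Nat Y Y') {n m} (r : Fin n → Fin m) (t : Ob Y n) →
                 _≈_ Y' (act Y' r (Step-map h t)) (Step-map h (act Y r t))
  Step-map-act {Y' = Y'} h r (inj₁ y) = inj₁ (IsEquivalence.sym (PSh.≈-eq Y') (natural h r y))
  Step-map-act {Y' = Y'} h r (inj₂ (inj₁ _)) = inj₂ (inj₁ (λ _ _ → IsEquivalence.refl (PSh.≈-eq Y')))
  Step-map-act h r (inj₂ (inj₂ _)) = inj₂ (inj₂ refl)

  Step-act-cong : ∀ (P : Presheaf) {n m} (r : Fin n → Fin m) {s t : Ob (U P) n} →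
                  _≈_ (U P) s t → _≈_ (U P) (act (U P) r s) (act (U P) r t)
  Step-act-cong P r (inj₁ q) = inj₁ (cong (Presheaf.act P r) q)
  Step-act-cong P r (inj₂ (inj₁ q)) = inj₂ (inj₁ (λ k (s , x) → q k (s ∘ r , x)))
  Step-act-cong P r (inj₂ (inj₂ q)) = inj₂ (inj₂ q)

  Step-map-represents-act :
    ∀ {D : PSh} (P : Presheaf) (γ : Coalg X (U P)) (q : Nat D (U P))
      {n m} (r : Fin n → Fin m) (u : Ob D n) (u' : Ob D m) {y : Presheaf.Ob P n} →
    _≈_ (U P) (Step-map q u) (comp₂ {X} {U P} γ y) →
    _≈_ (U P) (Step-map q u') (comp₂ {X} {U P} γ (Presheaf.act P r y)) →
    _≈_ (U P) (Step-map q u') (Step-map q (act D r u))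
  Step-map-represents-act P γ q r u u' {y} e e' =
    ≈-trans (U P) e' (≈-trans (U P) (proj₂ (natural γ r y))
      (≈-trans (U P) (Step-act-cong P r (≈-sym (U P) e)) (Step-map-act q r u)))

module Lifting (X W Z : Presheaf) (R : FamRel W Z) where
  private
    module SW = Step X (U W)
    module SZ = Step X (U Z)

  data Lift {n} : SW.Ob n → SZ.Ob n → Set where
    next  : ∀ {w z} → R n w z → Lift (inj₁ w) (inj₁ z)
    input : ∀ {f g} → (∀ e → R n (app X {U W} f e) (app X {U Z} g e)) →
            Lift (inj₂ (inj₁ f)) (inj₂ (inj₁ g))
    halt  : Lift (inj₂ (inj₂ tt)) (inj₂ (inj₂ tt))

  Lift-resp : ∀ {n} {s s' : SW.Ob n} {t t' : SZ.Ob n} →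
              s SW.≈ s' → t SZ.≈ t' → Lift s t → Lift s' t'
  Lift-resp (inj₁ refl) (inj₁ refl) (next q) = next q
  Lift-resp (inj₂ (inj₁ p)) (inj₂ (inj₁ p')) (input q) =
    input (λ e → subst₂ (R _) (p _ (id , e)) (p' _ (id , e)) (q e))
  Lift-resp (inj₂ (inj₂ _)) (inj₂ (inj₂ _)) halt = halt

  module _ {n} {s : SW.Ob n} {t : SZ.Ob n} where

    Lift⇒next→next : Lift s t → ∀ w' → s ≡ inj₁ w' → ∃[ z' ] (t ≡ inj₁ z' × R n w' z')
    Lift⇒next→next (next q) _ refl = _ , refl , q

    Lift⇒input→input : Lift s t → ∀ f → s ≡ inj₂ (inj₁ f) →
                       ∃[ g ] (t ≡ inj₂ (inj₁ g) × (∀ e → R n (app X {U W} f e) (app X {U Z} g e)))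
    Lift⇒input→input (input q) _ refl = _ , refl , q

    Lift⇒halt→halt : Lift s t → s ≡ inj₂ (inj₂ tt) → t ≡ inj₂ (inj₂ tt)
    Lift⇒halt→halt halt refl = refl

    Lift⇒next←next : Lift s t → ∀ z' → t ≡ inj₁ z' → ∃[ w' ] (s ≡ inj₁ w' × R n w' z')
    Lift⇒next←next (next q) _ refl = _ , refl , q

    Lift⇒input←input : Lift s t → ∀ g → t ≡ inj₂ (inj₁ g) →
                       ∃[ f ] (s ≡ inj₂ (inj₁ f) × (∀ e → R n (app X {U W} f e) (app X {U Z} g e)))
    Lift⇒input←input (input q) _ refl = _ , refl , q

    Lift⇒halt←halt : Lift s t → t ≡ inj₂ (inj₂ tt) → s ≡ inj₂ (inj₂ tt)
    Lift⇒halt←halt halt refl = refl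

  Lift-intro : ∀ {n} (s : SW.Ob n) (t : SZ.Ob n) →
    (∀ w' → s ≡ inj₁ w' → ∃[ z' ] (t ≡ inj₁ z' × R n w' z')) →
    (∀ f → s ≡ inj₂ (inj₁ f) →
      ∃[ g ] (t ≡ inj₂ (inj₁ g) × (∀ e → R n (app X {U W} f e) (app X {U Z} g e)))) →
    (s ≡ inj₂ (inj₂ tt) → t ≡ inj₂ (inj₂ tt)) →
    Lift s t
  Lift-intro (inj₁ w') _ next→ _ _ with next→ w' refl
  ... | _ , refl , q = next q
  Lift-intro (inj₂ (inj₁ f)) _ _ input→ _ with input→ f refl
  ... | _ , refl , q = input q
  Lift-intro (inj₂ (inj₂ tt)) _ _ _ halt→ with halt→ refl
  ... | refl = halt

module SubPresheaf (X W Z : Presheaf) {R : FamRel W Z} (cl : IsSubPresheaf W Z R) where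
  open Lifting X W Z R
  open StepMap X

  S : PSh
  S = SubPSh W Z R cl

  module SW = Step X (U W)
  module SZ = Step X (U Z)
  module SS = Step X S

  p₁ : Nat S (U W)
  p₁ = π₁ {W} {Z} {R} cl

  p₂ : Nat S (U Z)
  p₂ = π₂ {W} {Z} {R} cl

  pair : ∀ {D : PSh} (f : Nat D (U W)) (g : Nat D (U Z)) →
         (∀ k a → R k (η f k a) (η g k a)) → Nat D S
  pair f g fRg = record
    { η       = λ k a → η f k a , η g k a , fRg k a
    ; η-cong  = λ q → η-cong f q , η-cong g q
    ; natural = λ s a → natural f s a , natural g s a }

  pair-related : ∀ {D : PSh} (h : Nat D S) {f : Nat D (U W)} {g : Nat D (U Z)} →
                 postcomp X p₁ h ≈Nat f → postcomp X p₂ h ≈Nat g →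
                 ∀ k a → R k (η f k a) (η g k a)
  pair-related h p q k a = subst₂ (R k) (p k a) (q k a) (proj₂ (proj₂ (η h k a)))

  Step-map-p-jointly-injective : ∀ {n} (u u' : SS.Ob n) →
    Step-map p₁ u SW.≈ Step-map p₁ u' → Step-map p₂ u SZ.≈ Step-map p₂ u' → u SS.≈ u'
  Step-map-p-jointly-injective (inj₁ _) (inj₁ _) (inj₁ q) (inj₁ q') = inj₁ (q , q')
  Step-map-p-jointly-injective (inj₂ (inj₁ _)) (inj₂ (inj₁ _)) (inj₂ (inj₁ q)) (inj₂ (inj₁ q')) =
    inj₂ (inj₁ (λ k a → q k a , q' k a))
  Step-map-p-jointly-injective (inj₂ (inj₂ _)) (inj₂ (inj₂ _)) (inj₂ (inj₂ q)) _ = inj₂ (inj₂ q)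
  Step-map-p-jointly-injective (inj₁ _) (inj₂ _) () _
  Step-map-p-jointly-injective (inj₂ _) (inj₁ _) () _
  Step-map-p-jointly-injective (inj₂ (inj₁ _)) (inj₂ (inj₂ _)) (inj₂ ()) _
  Step-map-p-jointly-injective (inj₂ (inj₂ _)) (inj₂ (inj₁ _)) (inj₂ ()) _

  Represents : ∀ {n} → SS.Ob n → SW.Ob n → SZ.Ob n → Set
  Represents u s t = Step-map p₁ u SW.≈ s × Step-map p₂ u SZ.≈ t

  represented⇒Lift : ∀ {n} (u : SS.Ob n) {s t} → Represents u s t → Lift s t
  represented⇒Lift (inj₁ (_ , _ , q)) (inj₁ refl , inj₁ refl) = next q
  represented⇒Lift (inj₂ (inj₁ h)) {inj₂ (inj₁ f)} {inj₂ (inj₁ g)} (inj₂ (inj₁ p) , inj₂ (inj₁ q)) =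
    input (λ e → pair-related h {f} {g} p q _ (id , e))
  represented⇒Lift (inj₂ (inj₂ _)) (inj₂ (inj₂ refl) , inj₂ (inj₂ refl)) = halt

  Lift⇒represented : ∀ {n} {s : SW.Ob n} {t : SZ.Ob n} →
    (∀ {m} (r : Fin n → Fin m) → Lift (SW.act r s) (SZ.act r t)) →
    Lift s t → Σ[ u ∈ SS.Ob n ] Represents u s t
  Lift⇒represented _ (next {w} {z} q) = inj₁ (w , z , q) , inj₁ refl , inj₁ refl
  Lift⇒represented Lift-at (input {f} {g} _) =
    inj₂ (inj₁ (pair f g (λ k (r , x) → input-related (Lift-at r) x))) ,
    inj₂ (inj₁ (λ _ _ → refl)) , inj₂ (inj₁ (λ _ _ → refl))
    where
      input-related : ∀ {k} {f' : Nat (RepX X k) (U W)} {g' : Nat (RepX X k) (U Z)} →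
                      Lift (inj₂ (inj₁ f')) (inj₂ (inj₁ g')) →
                      ∀ e → R k (app X {U W} f' e) (app X {U Z} g' e)
      input-related (input q) = q
  Lift⇒represented _ halt = inj₂ (inj₂ tt) , inj₂ (inj₂ refl) , inj₂ (inj₂ refl)

module Characterisation (X W Z : Presheaf) (c : Coalg X (U W)) (d : Coalg X (U Z))
                        (R : FamRel W Z) where
  open Lifting X W Z R

  c₁ : ∀ {n} → Presheaf.Ob W n → Nat (Pow X n) (U W)
  c₁ = comp₁ {X} {U W} c
  c₂ : ∀ {n} → Presheaf.Ob W n → Step.Ob X (U W) n
  c₂ = comp₂ {X} {U W} c
  d₁ : ∀ {n} → Presheaf.Ob Z n → Nat (Pow X n) (U Z)
  d₁ = comp₁ {X} {U Z} d
  d₂ : ∀ {n} → Presheaf.Ob Z n → Step.Ob X (U Z) n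
  d₂ = comp₂ {X} {U Z} d

  module _ {n} {w : Presheaf.Ob W n} {z : Presheaf.Ob Z n} where
    conditions : Cond1 X W Z c d R w z → Cond2 X W Z c d R w z → Lift (c₂ w) (d₂ z) →
                 Conditions X W Z c d R w z
    conditions cond1 cond2 l =
      cond1 , cond2 , Lift⇒next→next l , Lift⇒input→input l , Lift⇒halt→halt l ,
      Lift⇒next←next l , Lift⇒input←input l , Lift⇒halt←halt l

    conditions⇒Lift : Conditions X W Z c d R w z → Lift (c₂ w) (d₂ z)
    conditions⇒Lift (_ , _ , cond3 , cond4 , cond5 , _) = Lift-intro (c₂ w) (d₂ z) cond3 cond4 cond5

  AllConditions : Set
  AllConditions = ∀ n (w : Presheaf.Ob W n) (z : Presheaf.Ob Z n) → R n w z →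
                  Conditions X W Z c d R w z

  bisimulation⇒conditions : IsBisimulation X W Z c d R → AllConditions
  bisimulation⇒conditions (cl , ρ , M₁ , M₂) n w z p =
    conditions (λ r → cl r w z p)
      (pair-related (proj₁ (η ρ n y)) {c₁ w} {d₁ z} (proj₁ (M₁ n y)) (proj₁ (M₂ n y)))
      (represented⇒Lift (proj₂ (η ρ n y)) (proj₂ (M₁ n y) , proj₂ (M₂ n y)))
    where
      open SubPresheaf X W Z cl
      y : PSh.Ob S n
      y = w , z , p

  module _ (H : AllConditions) where
    cl : IsSubPresheaf W Z R
    cl r w z p = proj₁ (H _ w z p) r

    open SubPresheaf X W Z cl
    open StepMap X

    Lift-act : ∀ {n m} (r : Fin n → Fin m) {w z} → R n w z →
               Lift (SW.act r (c₂ w)) (SZ.act r (d₂ z))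
    Lift-act r {w} {z} p =
      Lift-resp (proj₂ (natural c r w)) (proj₂ (natural d r z))
        (conditions⇒Lift (H _ _ _ (cl r w z p)))

    step : ∀ {n} (y : PSh.Ob S n) →
           Σ[ u ∈ SS.Ob n ] Represents u (c₂ (proj₁ y)) (d₂ (proj₁ (proj₂ y)))
    step (w , z , p) = Lift⇒represented (λ r → Lift-act r p) (conditions⇒Lift (H _ w z p))

    step-cong : ∀ {n} (y y' : PSh.Ob S n) → PSh._≈_ S y y' → proj₁ (step y) SS.≈ proj₁ (step y')
    step-cong y@(w , z , _) y'@(.w , .z , _) (refl , refl) with step y | step y'
    ... | u , u₁≈c₂ , u₂≈d₂ | u' , u'₁≈c₂ , u'₂≈d₂ =
      Step-map-p-jointly-injective u u'
        (SW.≈-trans u₁≈c₂ (SW.≈-sym u'₁≈c₂))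
        (SZ.≈-trans u₂≈d₂ (SZ.≈-sym u'₂≈d₂))

    step-natural : ∀ {n m} (r : Fin n → Fin m) (y : PSh.Ob S n) →
                   proj₁ (step (PSh.act S r y)) SS.≈ SS.act r (proj₁ (step y))
    step-natural r y with step y | step (PSh.act S r y)
    ... | u , u₁≈c₂ , u₂≈d₂ | u' , u'₁≈c₂ , u'₂≈d₂ =
      Step-map-p-jointly-injective u' (SS.act r u)
        (Step-map-represents-act W c p₁ r u u' u₁≈c₂ u'₁≈c₂)
        (Step-map-represents-act Z d p₂ r u u' u₂≈d₂ u'₂≈d₂)

    ρ : Coalg X S
    ρ = record
      { η       = λ { n y@(w , z , p) → pair (c₁ w) (d₁ z) (proj₁ (proj₂ (H n w z p))) , proj₁ (step y) }
      ; η-cong  = λ { {a = y} {b = y'} q@(refl , refl) → (λ _ _ → refl , refl) , step-cong y y' q }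
      ; natural = λ { r y@(w , z , _) →
                    (λ k u → proj₁ (natural c r w) k u , proj₁ (natural d r z) k u) , step-natural r y } }

    conditions⇒bisimulation : IsBisimulation X W Z c d R
    conditions⇒bisimulation =
      cl , ρ , (λ _ y → (λ _ _ → refl) , proj₁ (proj₂ (step y)))
             , (λ _ y → (λ _ _ → refl) , proj₂ (proj₂ (step y)))

proposition5p5 : (X W Z : Presheaf) (c : Coalg X (U W)) (d : Coalg X (U Z)) (R : FamRel W Z) →
    IsBisimulation X W Z c d R ⇔
      (∀ (n : ℕ) (w : Presheaf.Ob W n) (z : Presheaf.Ob Z n) → R n w z →
        Conditions X W Z c d R w z)
proposition5p5 X W Z c d R = mk⇔ bisimulation⇒conditions conditions⇒bisimulation
  where open Characterisation X W Z c d R
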